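{- Let $M=\langle W,\mathcal{N},\leq,V\rangle$ be a $\mathsf{W}$-PN-model. Then for every formula $\gamma$ and all $w,v\in W$: if $w\Vdash\gamma$ and $w\leq v$, then $v\Vdash\gamma$.
   Context: Formulas are built from a countable set $PV$ of propositional variables and $\bot$ by the binary connectives $\land,\lor,\rightarrow$ and a unary modal operator $\mathsf{W}$; $\lnot\varphi$ abbreviates $\varphi\rightarrow\bot$. A PN-frame is a triple $\langle W,\mathcal{N},\leq\rangle$ where $\leq$ is a partial order on the set $W$ and $\mathcal{N}:W\to P(P(W))$ (write $\mathcal{N}_w$ for $\mathcal{N}(w)$). A $\mathsf{W}$-PN-frame is a PN-frame satisfying: for all $w,v\in W$ and $X\subseteq W$, if $w\leq v$, $X\in\mathcal{N}_w$ and $v\notin X$, then $X\in\mathcal{N}_v$. A $\mathsf{W}$-PN-model is a quadruple $\langle W,\mathcal{N},\leq,V\rangle$ where $\langle W,\mathcal{N},\leq\rangle$ is a $\mathsf{W}$-PN-frame and $V:PV\to P(W)$ satisfies: if $w\in V(q)$ and $w\leq v$ then $v\in V(q)$. Forcing is defined by: $w\nVdash\bot$; $w\Vdash q$ iff $w\in V(q)$; $w\Vdash\varphi\land\psi$ (resp. $\varphi\lor\psi$) iff $w\Vdash\varphi$ and (resp. or) $w\Vdash\psi$; $w\Vdash\varphi\rightarrow\psi$ iff for every $v\geq w$, $v\nVdash\varphi$ or $v\Vdash\psi$; $w\Vdash\mathsf{W}\varphi$ iff $w\Vdash\lnot\varphi$ and $V(\varphi)\in\mathcal{N}_w$, where $V(\varphi)=\{z\in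 W: z\Vdash\varphi\}$. (Thus $w\Vdash\lnot\varphi$ iff no $v\geq w$ forces $\varphi$.) -}

module Defs where

open import Data.Nat using (ℕ)
open import Data.Empty using (⊥)
open import Data.Product using (_×_; _,_)
open import Data.Sum using (_⊎_)
open import Relation.Nullary using (¬_)
open import Relation.Binary.PropositionalEquality using (_≡_)
open import Relation.Binary.Structures using (IsPartialOrder)

data Form : Set where
  var  : ℕ → Form
  ⊥'   : Form
  _∧'_ : Form → Form → Form
  _∨'_ : Form → Form → Form
  _⇒'_ : Form → Form → Form
  𝖶    : Form → Form

¬' : Form → Form
¬' φ = φ ⇒' ⊥'

-- Subsets of W are predicates W → Set; P(P(W)) is (W → Set) → Set.
record WPNFrame : Set₁ where
  field
    World : Set
    _≤_   : World → World → Set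
    ≤-po  : IsPartialOrder _≡_ _≤_
    𝒩     : World → (World → Set) → Set
    W-cond : ∀ {w v} (X : World → Set) → w ≤ v → 𝒩 w X → ¬ X v → 𝒩 v X

record WPNModel : Set₁ where
  field
    frame : WPNFrame
  open WPNFrame frame public
  field
    V : ℕ → World → Set
    V-mono : ∀ q {w v} → V q w → w ≤ v → V q v

module _ (M : WPNModel) where
  open WPNModel M

  infix 4 _⊩_
  _⊩_ : World → Form → Set
  w ⊩ var q   = V q w
  w ⊩ ⊥'      = ⊥
  w ⊩ φ ∧' ψ  = (w ⊩ φ) × (w ⊩ ψ)
  w ⊩ φ ∨' ψ  = (w ⊩ φ) ⊎ (w ⊩ ψ)
  w ⊩ φ ⇒' ψ  = ∀ v → w ≤ v → ¬ (v ⊩ φ) ⊎ (v ⊩ ψ)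
  w ⊩ 𝖶 φ     = (∀ v → w ≤ v → ¬ (v ⊩ φ) ⊎ ⊥) × 𝒩 w (λ z → z ⊩ φ)
  -- first component is literally w ⊩ ¬' φ unfolded (¬' φ = φ ⇒' ⊥')

  ⟦_⟧ : Form → World → Set
  ⟦ φ ⟧ z = z ⊩ φ

  𝖶-neg-check : ∀ w φ → w ⊩ 𝖶 φ → w ⊩ ¬' φ
  𝖶-neg-check w φ (p , _) = p

module Submission where

open import Defs
open import Data.Product using (_,_)
open import Data.Sum using (inj₁; inj₂)
open import Relation.Nullary using (¬_)
open import Relation.Binary.Structures using (IsPartialOrder)

-- The 𝖶-clause is the only nontrivial case: its negation component is hereditary
-- like any implication, and by reflexivity it puts v outside V(φ), which is exactly
-- what the frame condition needs to transport V(φ) ∈ 𝒩_w to 𝒩_v.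

module Persistence (M : WPNModel) where
  open WPNModel M
  open IsPartialOrder ≤-po using (refl; trans)

  ⇒-persistent : ∀ φ ψ {w v} → _⊩_ M w (φ ⇒' ψ) → w ≤ v → _⊩_ M v (φ ⇒' ψ)
  ⇒-persistent φ ψ w⊩ w≤v u v≤u = w⊩ u (trans w≤v v≤u)

  ¬'-refutes : ∀ φ {w} → _⊩_ M w (¬' φ) → ¬ _⊩_ M w φ
  ¬'-refutes φ w⊩¬φ w⊩φ with w⊩¬φ _ refl
  ... | inj₁ w⊮φ = w⊮φ w⊩φ

  persistent : ∀ γ {w v} → _⊩_ M w γ → w ≤ v → _⊩_ M v γ
  persistent (var q)  w⊩q           w≤v = V-mono q w⊩q w≤v
  persistent ⊥'       ()
  persistent (φ ∧' ψ) (w⊩φ , w⊩ψ)   w≤v = persistent φ w⊩φ w≤v , persistent ψ w⊩ψ w≤v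
  persistent (φ ∨' ψ) (inj₁ w⊩φ)     w≤v = inj₁ (persistent φ w⊩φ w≤v)
  persistent (φ ∨' ψ) (inj₂ w⊩ψ)     w≤v = inj₂ (persistent ψ w⊩ψ w≤v)
  persistent (φ ⇒' ψ) w⊩φ⇒ψ         w≤v = ⇒-persistent φ ψ w⊩φ⇒ψ w≤v
  persistent (𝖶 φ) {v = v} (w⊩¬φ , ⟦φ⟧∈𝒩w) w≤v =
    v⊩¬φ , W-cond (⟦_⟧ M φ) w≤v ⟦φ⟧∈𝒩w (¬'-refutes φ v⊩¬φ)
    where
    v⊩¬φ : _⊩_ M v (¬' φ)
    v⊩¬φ = ⇒-persistent φ ⊥' w⊩¬φ w≤v

mainTheorem1 : (M : WPNModel) → (γ : Form) → (w v : WPNModel.World M) →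
    _⊩_ M w γ → WPNModel._≤_ M w v → _⊩_ M v γ
mainTheorem1 M γ w v = Persistence.persistent M γ
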